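{- Let $p$ be an odd prime and let $v,w\in\mathbb{F}_2^p$ be small vectors with $v_0=w_0=0$ such that $v+w$ is also small. Then $v$, $w$ and $\bar e$ work together if and only if there is no induced subgraph $H$ of $G$ on an odd number of vertices such that, for each vertex $i$ of $H$, the numbers of red, blue and green outneighbours of $i$ in $H$ are not all of the same parity.
   Context: Indices are mod $p$; $\sigma$ is the cyclic shift $(\sigma x)_{i+1}=x_i$. Vectors $v^{(1)},\dots,v^{(m)}\in\mathbb{F}_2^p$ work together if for every $x\in\mathbb{F}_2^p$ there is $k$ with $v^{(i)}\cdot\sigma^kx=0$ for all $i$. $\bar e\in\mathbb{F}_2^p$ has $\bar e_0=0$, $\bar e_i=1$ for $i\ne0$. A vector $u$ is small if there is no $i$ with $u_i=u_{ -i}=1$. $G$ is the edge-coloured digraph on $\mathbb{Z}/p\mathbb{Z}$ with: a green arc from $i$ to $i+j$ when $v_j=w_j=1$; a red arc from $i$ to $i+j$ when $v_j=1,w_j=0$; a blue arc from $i$ to $i+j$ when $v_j=0,w_j=1$. -}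

module Defs where

open import Data.Bool using (Bool; true; false; not; _∧_; _xor_; if_then_else_)
open import Data.Nat using (ℕ; zero; suc; _+_; _∸_; _≡ᵇ_; NonZero)
open import Data.Nat.DivMod using (_mod_)
open import Data.Fin using (Fin; toℕ)
open import Data.Vec.Functional using (foldr)
open import Data.Product using (Σ; ∃; _×_)
open import Data.List using (List)
open import Data.List.Relation.Unary.All using (All)
open import Relation.Binary.PropositionalEquality using (_≡_)
open import Relation.Nullary using (¬_)

-- Vectors of F_2^p, with F_2 = Bool (false = 0, true = 1, xor = +, ∧ = ·).
Vec₂ : ℕ → Set
Vec₂ p = Fin p → Bool

module _ (p : ℕ) .{{_ : NonZero p}} where

  _+ₚ_ : Fin p → Fin p → Fin p
  i +ₚ j = (toℕ i + toℕ j) mod p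

  -ₚ_ : Fin p → Fin p
  -ₚ i = (p ∸ toℕ i) mod p

  _-ₚ_ : Fin p → Fin p → Fin p
  i -ₚ j = i +ₚ (-ₚ j)

  Σ₂ : Vec₂ p → Bool
  Σ₂ f = foldr _xor_ false f

  dot : Vec₂ p → Vec₂ p → Bool
  dot v x = Σ₂ (λ i → v i ∧ x i)

  -- σ^k x, where (σ x)_{i+1} = x_i, hence (σ^k x)_i = x_{i-k}
  shift : Fin p → Vec₂ p → Vec₂ p
  shift k x i = x (i -ₚ k)

  WorkTogether : List (Vec₂ p) → Set
  WorkTogether vs = (x : Vec₂ p) → ∃ λ (k : Fin p) →
    All (λ v → dot v (shift k x) ≡ false) vs

  ebar : Vec₂ p
  ebar i = not (toℕ i ≡ᵇ 0)

  Small : Vec₂ p → Set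
  Small u = ¬ (∃ λ (i : Fin p) → (u i ≡ true) × (u (-ₚ i) ≡ true))

  _⊕_ : Vec₂ p → Vec₂ p → Vec₂ p
  (v ⊕ w) i = v i xor w i

  card : (Fin p → Bool) → ℕ
  card S = foldr (λ b n → if b then suc n else n) 0 S

  -- arcs of the coloured digraph G (built from v, w): arc from i to i + j
  greenArc redArc blueArc : Vec₂ p → Vec₂ p → Fin p → Fin p → Bool
  greenArc v w i t = v (t -ₚ i) ∧ w (t -ₚ i)
  redArc   v w i t = v (t -ₚ i) ∧ not (w (t -ₚ i))
  blueArc  v w i t = not (v (t -ₚ i)) ∧ w (t -ₚ i)

  outdeg : (Fin p → Fin p → Bool) → (Fin p → Bool) → Fin p → ℕ
  outdeg arc S i = card (λ t → S t ∧ arc i t)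

  odd? : ℕ → Bool
  odd? zero = false
  odd? (suc n) = not (odd? n)

  BadSubgraph : Vec₂ p → Vec₂ p → (Fin p → Bool) → Set
  BadSubgraph v w S =
    (odd? (card S) ≡ true) ×
    ((i : Fin p) → S i ≡ true →
      ¬ ((odd? (outdeg (redArc v w) S i) ≡ odd? (outdeg (blueArc v w) S i)) ×
         (odd? (outdeg (blueArc v w) S i) ≡ odd? (outdeg (greenArc v w) S i))))

module Submission where

-- Write P = p, index everything by Z/PZ and read a Bool as an element
-- of F₂.  For u, x ∈ F₂^P and m ∈ Z/PZ put  deg u x m = Σ_t x_t u_{t-m} , the parity of
-- the number of out-neighbours of m inside supp x in the circulant digraph of u.
-- Reindexing the dot product gives  u · σ^k x = deg u x (-k)  and
-- ē · σ^k x = Σ x + x_{-k}.  Hence v, w, ē work together iff every x has a *centre*: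
-- a vertex m with x_m = Σ x and deg v x m = deg w x m = 0.
-- Splitting v-arcs into red and green and w-arcs into blue and green shows that
-- deg v S m = 0 and deg w S m = 0 hold exactly when the red, blue and green
-- out-degrees of m in S have equal parity (m is *balanced* in S).
--   (⇒) An odd S has a centre m; then S_m = Σ S = 1 and m is balanced, so S is not bad.
--   (⇐) Without bad subgraphs every odd S has a balanced vertex in S.  Taking S = Z/PZ
--   (odd since P is an odd prime) gives Σ v = Σ w = 0.  If Σ x = 1, a balanced vertex
--   of x is a centre; if Σ x = 0, a balanced vertex of the (odd) complement of x is,
--   because Σ v = Σ w = 0 makes deg u (¬x) m = deg u x m.

open import Defs
open import Data.Bool using (Bool; true; false; not; _∧_; _xor_; if_then_else_)
open import Data.Bool.Properties using (xor-∧-commutativeRing; xor-same; xor-identityʳ; ∧-comm; not-involutive)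
  renaming (_≟_ to _≟ᴮ_)
open import Data.Nat using (ℕ; zero; suc; NonZero; _+_; _∸_; _%_)
open import Data.Nat.Properties using (+-assoc; +-comm; m+[n∸m]≡n; <⇒≤)
open import Data.Nat.DivMod using (_mod_; m%n<n; %-distribˡ-+; [m+n]%n≡m%n; n%n≡0; m<n⇒m%n≡m)
open import Data.Nat.Divisibility using (_∣_; divides)
open import Data.Nat.Primality using (Prime; composite-≢; prime⇒¬composite; ¬prime[0])
open import Data.Fin using (Fin; toℕ)
open import Data.Fin.Properties using (toℕ-fromℕ<; toℕ-injective; toℕ<n; any?)
open import Data.Fin.Permutation using (permutation)
open import Data.Vec.Functional using (foldr)
open import Data.List using (_∷_; [])
open import Data.List.Relation.Unary.All using (All; _∷_; [])
open import Data.Product using (∃; _×_; _,_)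
open import Data.Empty using (⊥; ⊥-elim)
open import Function using (_∘_)
open import Function.Bundles using (_⇔_; mk⇔; Equivalence)
open import Relation.Nullary using (¬_; yes; no)
open import Relation.Nullary.Decidable using (_×-dec_)
open import Relation.Binary.PropositionalEquality
  using (_≡_; _≢_; refl; sym; trans; cong; cong₂; subst; module ≡-Reasoning)
open import Algebra.Bundles using (CommutativeRing)
import Algebra.Properties.CommutativeMonoid.Sum as MonoidSum

open ≡-Reasoning

-- Sums over F₂: Defs' Σ₂ is, definitionally, the sum in the additive monoid (Bool, xor).
open MonoidSum (CommutativeRing.+-commutativeMonoid xor-∧-commutativeRing)
  using (sum; sum-cong-≗; ∑-distrib-+; sum-permute)

sum-reindex : ∀ {m} (f : Fin m → Bool) (g h : Fin m → Fin m) →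
  (∀ y → g (h y) ≡ y) → (∀ y → h (g y) ≡ y) → sum f ≡ sum (f ∘ g)
sum-reindex f g h gh hg = sum-permute f (permutation g h gh hg)

xor-≡ : ∀ {a b} → a ≡ b → a xor b ≡ false
xor-≡ {a} refl = xor-same a

xor-false : ∀ a b → a xor b ≡ false → a ≡ b
xor-false false false _ = refl
xor-false true  true  _ = refl

xor-cancel : ∀ a b → (a xor b) xor a ≡ b
xor-cancel false false = refl
xor-cancel false true  = refl
xor-cancel true  false = refl
xor-cancel true  true  = refl

red+green-pointwise : ∀ s a c → (s ∧ (a ∧ not c)) xor (s ∧ (a ∧ c)) ≡ s ∧ a
red+green-pointwise false a c = refl
red+green-pointwise true false c = refl
red+green-pointwise true true false = refl
red+green-pointwise true true true = refl

blue+green-pointwise : ∀ s a c → (s ∧ (not a ∧ c)) xor (s ∧ (a ∧ c)) ≡ s ∧ c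
blue+green-pointwise false a c = refl
blue+green-pointwise true false false = refl
blue+green-pointwise true false true = refl
blue+green-pointwise true true false = refl
blue+green-pointwise true true true = refl

complement-pointwise : ∀ s c → not s ∧ c ≡ c xor (s ∧ c)
complement-pointwise false c = sym (xor-identityʳ c)
complement-pointwise true c = sym (xor-same c)

module Cyclic (n : ℕ) where

  P : ℕ
  P = suc n

  infixl 6 _⊞_ _⊟_
  _⊞_ _⊟_ : Fin P → Fin P → Fin P
  _⊞_ = _+ₚ_ P
  _⊟_ = _-ₚ_ P

  ⊟_ : Fin P → Fin P
  ⊟_ = -ₚ_ P

  toℕ-mod : ∀ a → toℕ (a mod P) ≡ a % P
  toℕ-mod a = toℕ-fromℕ< (m%n<n a P)

  mod-cong : ∀ a b → a % P ≡ b % P → a mod P ≡ b mod P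
  mod-cong a b eq = toℕ-injective (trans (toℕ-mod a) (trans eq (sym (toℕ-mod b))))

  toℕ-mod-id : ∀ (i : Fin P) → toℕ i mod P ≡ i
  toℕ-mod-id i = toℕ-injective (trans (toℕ-mod (toℕ i)) (m<n⇒m%n≡m (toℕ<n i)))

  mod-+ : ∀ a b → (a mod P) ⊞ (b mod P) ≡ (a + b) mod P
  mod-+ a b = mod-cong (toℕ (a mod P) + toℕ (b mod P)) (a + b) (begin
    (toℕ (a mod P) + toℕ (b mod P)) % P ≡⟨ cong₂ (λ x y → (x + y) % P) (toℕ-mod a) (toℕ-mod b) ⟩
    (a % P + b % P) % P                 ≡⟨ %-distribˡ-+ a b P ⟨
    (a + b) % P                         ∎)

  ⊟-as-mod : ∀ i m → i ⊟ m ≡ (toℕ i + (P ∸ toℕ m)) mod P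
  ⊟-as-mod i m = trans (cong (_⊞ (⊟ m)) (sym (toℕ-mod-id i))) (mod-+ (toℕ i) (P ∸ toℕ m))

  add-sub-P : ∀ a (m : Fin P) → (a + toℕ m + (P ∸ toℕ m)) mod P ≡ a mod P
  add-sub-P a m = begin
    (a + toℕ m + (P ∸ toℕ m)) mod P ≡⟨ cong (_mod P) (+-assoc a (toℕ m) (P ∸ toℕ m)) ⟩
    (a + (toℕ m + (P ∸ toℕ m))) mod P ≡⟨ cong (λ k → (a + k) mod P) (m+[n∸m]≡n (<⇒≤ (toℕ<n m))) ⟩
    (a + P) mod P ≡⟨ mod-cong (a + P) a ([m+n]%n≡m%n a P) ⟩
    a mod P ∎

  zero-⊞ : ∀ m → Fin.zero ⊞ m ≡ m
  zero-⊞ = toℕ-mod-id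

  ⊞-⊟ : ∀ i m → (i ⊞ m) ⊟ m ≡ i
  ⊞-⊟ i m = begin
    (i ⊞ m) ⊟ m                            ≡⟨ mod-+ (toℕ i + toℕ m) (P ∸ toℕ m) ⟩
    (toℕ i + toℕ m + (P ∸ toℕ m)) mod P    ≡⟨ add-sub-P (toℕ i) m ⟩
    toℕ i mod P                            ≡⟨ toℕ-mod-id i ⟩
    i                                      ∎

  ⊟-⊞ : ∀ i m → (i ⊟ m) ⊞ m ≡ i
  ⊟-⊞ i m = begin
    (i ⊟ m) ⊞ m                                       ≡⟨ cong₂ _⊞_ (⊟-as-mod i m) (sym (toℕ-mod-id m)) ⟩
    ((toℕ i + (P ∸ toℕ m)) mod P) ⊞ (toℕ m mod P)     ≡⟨ mod-+ (toℕ i + (P ∸ toℕ m)) (toℕ m) ⟩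
    (toℕ i + (P ∸ toℕ m) + toℕ m) mod P               ≡⟨ cong (_mod P) (+-assoc (toℕ i) (P ∸ toℕ m) (toℕ m)) ⟩
    (toℕ i + ((P ∸ toℕ m) + toℕ m)) mod P             ≡⟨ cong (λ k → (toℕ i + k) mod P) (+-comm (P ∸ toℕ m) (toℕ m)) ⟩
    (toℕ i + (toℕ m + (P ∸ toℕ m))) mod P             ≡⟨ cong (_mod P) (+-assoc (toℕ i) (toℕ m) (P ∸ toℕ m)) ⟨
    (toℕ i + toℕ m + (P ∸ toℕ m)) mod P               ≡⟨ add-sub-P (toℕ i) m ⟩
    toℕ i mod P                                       ≡⟨ toℕ-mod-id i ⟩
    i                                                 ∎

  ⊞-inverse : ∀ m → m ⊞ (⊟ m) ≡ Fin.zero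
  ⊞-inverse m = toℕ-injective (begin
    toℕ (m ⊟ m)                               ≡⟨ cong toℕ (⊟-as-mod m m) ⟩
    toℕ ((toℕ m + (P ∸ toℕ m)) mod P)         ≡⟨ toℕ-mod (toℕ m + (P ∸ toℕ m)) ⟩
    (toℕ m + (P ∸ toℕ m)) % P                 ≡⟨ cong (_% P) (m+[n∸m]≡n (<⇒≤ (toℕ<n m))) ⟩
    P % P                                     ≡⟨ n%n≡0 P ⟩
    0                                         ∎)

  ⊟-involutive : ∀ m → ⊟ (⊟ m) ≡ m
  ⊟-involutive m = begin
    ⊟ (⊟ m)                 ≡⟨ zero-⊞ (⊟ (⊟ m)) ⟨
    Fin.zero ⊟ (⊟ m)        ≡⟨ cong (_⊟ (⊟ m)) (⊞-inverse m) ⟨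
    (m ⊞ (⊟ m)) ⊟ (⊟ m)     ≡⟨ ⊞-⊟ m (⊟ m) ⟩
    m                       ∎

  sum-translate : ∀ (f : Vec₂ P) q → sum (λ i → f (i ⊞ q)) ≡ sum f
  sum-translate f q = sym (sum-reindex f (_⊞ q) (_⊟ q) (λ y → ⊟-⊞ y q) (λ y → ⊞-⊟ y q))

  sum-translate⁻ : ∀ (f : Vec₂ P) q → sum (λ i → f (i ⊟ q)) ≡ sum f
  sum-translate⁻ f q = sym (sum-reindex f (_⊟ q) (_⊞ q) (λ y → ⊞-⊟ y q) (λ y → ⊟-⊞ y q))

  count : ∀ {m} → (Fin m → Bool) → ℕ
  count = foldr (λ b k → if b then suc k else k) 0

  parity-count : ∀ {m} (f : Fin m → Bool) → odd? P (count f) ≡ sum f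
  parity-count {zero} f = refl
  parity-count {suc m} f with f Fin.zero
  ... | true  = cong not (parity-count (f ∘ Fin.suc))
  ... | false = parity-count (f ∘ Fin.suc)

  sum-true : ∀ m → sum {m} (λ _ → true) ≡ odd? P m
  sum-true zero = refl
  sum-true (suc m) = cong not (sum-true m)

  even⇒2∣ : ∀ k → odd? P k ≡ false → 2 ∣ k
  even⇒2∣ zero _ = divides 0 refl
  even⇒2∣ (suc (suc k)) e with even⇒2∣ k (trans (sym (not-involutive (odd? P k))) e)
  ... | divides q eq = divides (suc q) (cong (suc ∘ suc) eq)

  odd-prime : Prime P → P ≢ 2 → odd? P P ≡ true
  odd-prime pr P≢2 with odd? P P in eq
  ... | true  = refl
  ... | false = ⊥-elim (prime⇒¬composite pr (composite-≢ 2 (P≢2 ∘ sym) (even⇒2∣ P eq)))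

  full-odd : Prime P → P ≢ 2 → odd? P (card P (λ _ → true)) ≡ true
  full-odd pr P≢2 = trans (parity-count {P} (λ _ → true)) (trans (sum-true P) (odd-prime pr P≢2))

  complement-odd : Prime P → P ≢ 2 → ∀ x → sum x ≡ false → odd? P (card P (not ∘ x)) ≡ true
  complement-odd pr P≢2 x Σx≡0 = begin
    odd? P (card P (not ∘ x))          ≡⟨ parity-count (not ∘ x) ⟩
    sum (λ t → true xor x t)           ≡⟨ ∑-distrib-+ (λ _ → true) x ⟩
    sum {P} (λ _ → true) xor sum x     ≡⟨ cong₂ _xor_ (trans (sum-true P) (odd-prime pr P≢2)) Σx≡0 ⟩
    true                               ∎

  -- Degrees.  deg u x m is the parity of the number of out-neighbours of m in supp x
  -- in the circulant digraph with an arc m → m + j whenever u_j = 1.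
  deg : Vec₂ P → Vec₂ P → Fin P → Bool
  deg u x m = sum (λ t → x t ∧ u (t ⊟ m))

  dot-shift : ∀ u x k → dot P u (shift P k x) ≡ deg u x (⊟ k)
  dot-shift u x k = begin
    sum (λ i → u i ∧ x (i ⊞ q))                ≡⟨ sum-cong-≗ commute ⟩
    sum (λ i → x (i ⊞ q) ∧ u ((i ⊞ q) ⊟ q))    ≡⟨ sum-translate (λ t → x t ∧ u (t ⊟ q)) q ⟩
    deg u x q                                  ∎
    where
    q = ⊟ k
    commute : ∀ i → u i ∧ x (i ⊞ q) ≡ x (i ⊞ q) ∧ u ((i ⊞ q) ⊟ q)
    commute i = trans (∧-comm (u i) _) (cong (λ j → x (i ⊞ q) ∧ u j) (sym (⊞-⊟ i q)))

  dot-ebar : ∀ y → dot P (ebar P) y ≡ sum y xor y Fin.zero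
  dot-ebar y = sym (xor-cancel (y Fin.zero) (sum (y ∘ Fin.suc)))

  dot-ebar-shift : ∀ x k → dot P (ebar P) (shift P k x) ≡ sum x xor x (⊟ k)
  dot-ebar-shift x k = trans (dot-ebar (shift P k x))
    (cong₂ _xor_ (sum-translate x (⊟ k)) (cong x (zero-⊞ (⊟ k))))

  deg-full : ∀ u m → deg u (λ _ → true) m ≡ sum u
  deg-full u m = sum-translate⁻ u m

  deg-complement : ∀ u x m → sum u ≡ false → deg u (not ∘ x) m ≡ deg u x m
  deg-complement u x m Σu≡0 = begin
    sum (λ t → not (x t) ∧ u (t ⊟ m))                  ≡⟨ sum-cong-≗ (λ t → complement-pointwise (x t) (u (t ⊟ m))) ⟩
    sum (λ t → u (t ⊟ m) xor (x t ∧ u (t ⊟ m)))        ≡⟨ ∑-distrib-+ (λ t → u (t ⊟ m)) (λ t → x t ∧ u (t ⊟ m)) ⟩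
    sum (λ t → u (t ⊟ m)) xor deg u x m                ≡⟨ cong (_xor deg u x m) (trans (sum-translate⁻ u m) Σu≡0) ⟩
    deg u x m                                          ∎

  module Colours (v w : Vec₂ P) where

    red blue green : Vec₂ P → Fin P → Bool
    red   S i = odd? P (outdeg P (redArc P v w) S i)
    blue  S i = odd? P (outdeg P (blueArc P v w) S i)
    green S i = odd? P (outdeg P (greenArc P v w) S i)

    -- v-arcs are the red and green arcs; w-arcs are the blue and green arcs.
    red+green : ∀ S i → red S i xor green S i ≡ deg v S i
    red+green S i = begin
      red S i xor green S i
        ≡⟨ cong₂ _xor_ (parity-count (λ t → S t ∧ redArc P v w i t)) (parity-count (λ t → S t ∧ greenArc P v w i t)) ⟩
      sum (λ t → S t ∧ redArc P v w i t) xor sum (λ t → S t ∧ greenArc P v w i t)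
        ≡⟨ ∑-distrib-+ (λ t → S t ∧ redArc P v w i t) (λ t → S t ∧ greenArc P v w i t) ⟨
      sum (λ t → (S t ∧ redArc P v w i t) xor (S t ∧ greenArc P v w i t))
        ≡⟨ sum-cong-≗ (λ t → red+green-pointwise (S t) (v (t ⊟ i)) (w (t ⊟ i))) ⟩
      deg v S i ∎

    blue+green : ∀ S i → blue S i xor green S i ≡ deg w S i
    blue+green S i = begin
      blue S i xor green S i
        ≡⟨ cong₂ _xor_ (parity-count (λ t → S t ∧ blueArc P v w i t)) (parity-count (λ t → S t ∧ greenArc P v w i t)) ⟩
      sum (λ t → S t ∧ blueArc P v w i t) xor sum (λ t → S t ∧ greenArc P v w i t)
        ≡⟨ ∑-distrib-+ (λ t → S t ∧ blueArc P v w i t) (λ t → S t ∧ greenArc P v w i t) ⟨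
      sum (λ t → (S t ∧ blueArc P v w i t) xor (S t ∧ greenArc P v w i t))
        ≡⟨ sum-cong-≗ (λ t → blue+green-pointwise (S t) (v (t ⊟ i)) (w (t ⊟ i))) ⟩
      deg w S i ∎

    Balanced : Vec₂ P → Fin P → Set
    Balanced S i = (red S i ≡ blue S i) × (blue S i ≡ green S i)

    balanced⇒deg : ∀ S i → Balanced S i → (deg v S i ≡ false) × (deg w S i ≡ false)
    balanced⇒deg S i (r≡b , b≡g) =
      trans (sym (red+green S i)) (xor-≡ (trans r≡b b≡g)) , trans (sym (blue+green S i)) (xor-≡ b≡g)

    deg⇒balanced : ∀ S i → deg v S i ≡ false → deg w S i ≡ false → Balanced S i
    deg⇒balanced S i dv dw = trans r≡g (sym b≡g) , b≡g
      where
      r≡g = xor-false (red S i) (green S i) (trans (red+green S i) dv)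
      b≡g = xor-false (blue S i) (green S i) (trans (blue+green S i) dw)

    -- m is a centre of x when the shift moving m to 0 makes x orthogonal to v, w and ē.
    Centre : Vec₂ P → Fin P → Set
    Centre x m = (x m ≡ sum x) × (deg v x m ≡ false) × (deg w x m ≡ false)

    Annihilates : Fin P → Vec₂ P → Set
    Annihilates k x = All (λ u → dot P u (shift P k x) ≡ false) (v ∷ w ∷ ebar P ∷ [])

    annihilates⇔centre : ∀ x k → Annihilates k x ⇔ Centre x (⊟ k)
    annihilates⇔centre x k = mk⇔
      (λ { (dv ∷ dw ∷ de ∷ []) →
             sym (xor-false (sum x) (x (⊟ k)) (trans (sym (dot-ebar-shift x k)) de))
           , trans (sym (dot-shift v x k)) dv
           , trans (sym (dot-shift w x k)) dw })
      (λ { (xm , dv , dw) →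
             trans (dot-shift v x k) dv
           ∷ trans (dot-shift w x k) dw
           ∷ trans (dot-ebar-shift x k) (xor-≡ (sym xm))
           ∷ [] })

    workTogether⇔centres : WorkTogether P (v ∷ w ∷ ebar P ∷ []) ⇔ (∀ x → ∃ (Centre x))
    workTogether⇔centres = mk⇔
      (λ wt x → centre-of (wt x))
      (λ cs x → shift-of (cs x))
      where
      centre-of : ∀ {x} → ∃ (λ k → Annihilates k x) → ∃ (Centre x)
      centre-of {x} (k , ann) = ⊟ k , Equivalence.to (annihilates⇔centre x k) ann

      shift-of : ∀ {x} → ∃ (Centre x) → ∃ (λ k → Annihilates k x)
      shift-of {x} (m , c) =
        ⊟ m , Equivalence.from (annihilates⇔centre x (⊟ m)) (subst (Centre x) (sym (⊟-involutive m)) c)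

    -- A centre of an odd set S is a balanced vertex of S, so S is not bad.
    centres⇒noBad : (∀ x → ∃ (Centre x)) → ¬ ∃ (BadSubgraph P v w)
    centres⇒noBad cs (S , S-odd , bad) =
      balanced-centre (cs S)
      where
      balanced-centre : ∃ (Centre S) → ⊥
      balanced-centre (m , Sm≡ΣS , dv , dw) =
        bad m (trans Sm≡ΣS (trans (sym (parity-count S)) S-odd)) (deg⇒balanced S m dv dw)

    module NoBad (pr : Prime P) (P≢2 : P ≢ 2) (noBad : ¬ ∃ (BadSubgraph P v w)) where

      balanced-vertex : ∀ S → odd? P (card P S) ≡ true → ∃ λ m → (S m ≡ true) × Balanced S m
      balanced-vertex S S-odd with any? (λ i → (S i ≟ᴮ true) ×-dec ((red S i ≟ᴮ blue S i) ×-dec (blue S i ≟ᴮ green S i)))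
      ... | yes found = found
      ... | no none = ⊥-elim (noBad (S , S-odd , λ i Si bal → none (i , Si , bal)))

      -- A balanced vertex of the full set has v- and w-degree Σ v and Σ w.
      sum-v-w-zero : (sum v ≡ false) × (sum w ≡ false)
      sum-v-w-zero = from-full (balanced-vertex (λ _ → true) (full-odd pr P≢2))
        where
        from-full : ∃ (λ m → (true ≡ true) × Balanced (λ _ → true) m) → (sum v ≡ false) × (sum w ≡ false)
        from-full (m , _ , bal) =
          let (dv , dw) = balanced⇒deg (λ _ → true) m bal
          in trans (sym (deg-full v m)) dv , trans (sym (deg-full w m)) dw

      not-true : ∀ {a} → not a ≡ true → a ≡ false
      not-true {false} _ = refl

      -- Odd x: a balanced vertex of x is a centre.
      centre-odd : ∀ x → sum x ≡ true → ∃ (Centre x)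
      centre-odd x Σx≡1 = centre (balanced-vertex x (trans (parity-count x) Σx≡1))
        where
        centre : ∃ (λ m → (x m ≡ true) × Balanced x m) → ∃ (Centre x)
        centre (m , xm , bal) = m , trans xm (sym Σx≡1) , balanced⇒deg x m bal

      -- Even x: a balanced vertex of the complement of x is a centre, as Σ v = Σ w = 0.
      centre-even : ∀ x → sum x ≡ false → ∃ (Centre x)
      centre-even x Σx≡0 = centre (balanced-vertex (not ∘ x) (complement-odd pr P≢2 x Σx≡0))
        where
        centre : ∃ (λ m → (not (x m) ≡ true) × Balanced (not ∘ x) m) → ∃ (Centre x)
        centre (m , ¬xm , bal) =
          let (dv , dw) = balanced⇒deg (not ∘ x) m bal
              (Σv≡0 , Σw≡0) = sum-v-w-zero
          in m , trans (not-true ¬xm) (sym Σx≡0)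
               , trans (sym (deg-complement v x m Σv≡0)) dv
               , trans (sym (deg-complement w x m Σw≡0)) dw

      centre-by-parity : ∀ x b → sum x ≡ b → ∃ (Centre x)
      centre-by-parity x true  = centre-odd x
      centre-by-parity x false = centre-even x

      centres : ∀ x → ∃ (Centre x)
      centres x = centre-by-parity x (sum x) refl

proposition5p2 : (p : ℕ) .{{_ : NonZero p}} → Prime p → p ≢ 2 →
    (v w : Vec₂ p) → Small p v → Small p w →
    v (0 mod p) ≡ false → w (0 mod p) ≡ false →
    Small p (_⊕_ p v w) →
    (WorkTogether p (v ∷ w ∷ ebar p ∷ [])
      ⇔ (¬ (∃ λ (S : Fin p → Bool) → BadSubgraph p v w S)))
proposition5p2 zero pr _ _ _ _ _ _ _ _ = ⊥-elim (¬prime[0] pr)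
proposition5p2 (suc n) pr p≢2 v w _ _ _ _ _ = mk⇔
  (centres⇒noBad ∘ Equivalence.to workTogether⇔centres)
  (Equivalence.from workTogether⇔centres ∘ NoBad.centres pr p≢2)
  where open Cyclic.Colours n v w
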